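{- Let $n\ge1$, $d\ge0$ and let $u$ and $v$ be sorted compact configurations on $S_{n,d}$. (a) If $u=T_W.v$ then $u^{[I]}=v^{[I]}$; more generally, if $u\equiv_{T_W}v$ then $u^{[I]}=v^{[I]}$. (b) The sub-configuration $u^{[K]}$ is quasi-stable and non-negative (i.e. $0\le u^{[K]}_k\le n+d$ for all $k$) if and only if $\mathsf{weight}(u^{[K]})=0$. (c) $\mathsf{weight}((T_W.u)^{[K]})=\mathsf{weight}(u^{[K]})-1$, and the clique sub-configuration $(T_W^{\mathsf{weight}(u^{[K]})}.u)^{[K]}$ is the (unique) quasi-stable and non-negative one among the clique sub-configurations $(T_W^t.u)^{[K]}$, $t\in\mathbb{Z}$.
   Context: The complete split graph $S_{n,d}$ has a sink $s$, clique component $K=\{v_1,\ldots,v_n\}$ (positions $0,\ldots,n-1$) and independent component $I=\{w_1,\ldots,w_d\}$; any two distinct vertices among $s,v_1,\ldots,v_n$ are adjacent, each $w_j$ is adjacent to each of $s,v_1,\ldots,v_n$, no two $w_j$'s are adjacent; $\deg(v_i)=\deg(s)=n+d$, $\deg(w_j)=n+1$. A configuration is any $u=(u^{[K]};u^{[I]})\in\mathbb{Z}^n\times\mathbb{Z}^d$, the sink carrying $u_s=-(\text{sum of all entries})$. $\Delta^{(v)}$ is the toppling vector of vertex $v$: adding it removes $\deg(v)$ grains from $v$ and adds one to each neighbour. Sorted: $u^{[K]}$ and $u^{[I]}$ weakly decreasing; $\mathsf{sort}(u)$ sorts each part. Compact: $\max u^{[K]}-\min u^{[K]}\le n+d+1$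 and $\max u^{[I]}-\min u^{[I]}\le n+1$. For $C\in\{K,I\}$, $T_C.u=\mathsf{sort}(u+\Delta^{(c)})$ with $c$ a vertex of maximal grain number in $C$. On the set of sorted compact configurations $T_K$ and $T_I$ are bijections, so powers with any integer exponent are defined there. The weight operator is $T_W=T_K^{n+1}T_I^{d}$, and $u\equiv_{T_W}v$ means $u=T_W^t.v$ for some $t\in\mathbb{Z}$. The weight of a clique sub-configuration is $\mathsf{weight}(u^{[K]})=\sum_{k}\left\lfloor u^{[K]}_k/(n+d+1)\right\rfloor$. -}

module Defs where

open import Data.Nat as ℕ using (ℕ; zero; suc)
open import Data.Integer using (ℤ; +_; -[1+_]; _+_; _-_; _≤_; _≤?_)
open import Data.Integer.DivMod using (_/ℕ_)
open import Data.Fin using (Fin; zero; suc) renaming (_≤_ to _≤ᶠ_)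
open import Data.Vec using (Vec; []; _∷_; map; lookup; updateAt; foldr)
open import Data.Product using (_×_; _,_; proj₁; proj₂; ∃)
open import Relation.Binary.PropositionalEquality using (_≡_)
open import Relation.Nullary using (yes; no)

-- A configuration on S_{n,d}: (u^[K] ; u^[I]) ∈ ℤ^n × ℤ^d.
-- (The sink value is determined as minus the sum of all entries, so it is not stored.)
Config : ℕ → ℕ → Set
Config n d = Vec ℤ n × Vec ℤ d

clique : ∀ {n d} → Config n d → Vec ℤ n
clique = proj₁

indep : ∀ {n d} → Config n d → Vec ℤ d
indep = proj₂

SortedVec : ∀ {m} → Vec ℤ m → Set
SortedVec {m} x = ∀ (i j : Fin m) → i ≤ᶠ j → lookup x j ≤ lookup x i

Sorted : ∀ {n d} → Config n d → Set
Sorted (k , i) = SortedVec k × SortedVec i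

-- max x - min x ≤ b, written as: every difference of entries is ≤ b.
Spread≤ : ∀ {m} → Vec ℤ m → ℕ → Set
Spread≤ {m} x b = ∀ (i j : Fin m) → lookup x i - lookup x j ≤ + b

Compact : ∀ {n d} → Config n d → Set
Compact {n} {d} (k , i) = Spread≤ k (suc (n ℕ.+ d)) × Spread≤ i (suc n)

SortedCompact : ∀ {n d} → Config n d → Set
SortedCompact u = Sorted u × Compact u

insertDesc : ∀ {m} → ℤ → Vec ℤ m → Vec ℤ (suc m)
insertDesc x [] = x ∷ []
insertDesc x (y ∷ ys) with y ≤? x
... | yes _ = x ∷ y ∷ ys
... | no _  = y ∷ insertDesc x ys

sortVec : ∀ {m} → Vec ℤ m → Vec ℤ m
sortVec [] = []
sortVec (x ∷ xs) = insertDesc x (sortVec xs)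

sort : ∀ {n d} → Config n d → Config n d
sort (k , i) = (sortVec k , sortVec i)

inc : ℤ → ℤ
inc z = z + + 1

-- Toppling vectors, added to a configuration.
-- Δ^(v_p): v_p loses deg = n+d grains, every other clique vertex, every w_j (and the sink) gains one.
addΔK : ∀ {n d} → Fin n → Config n d → Config n d
addΔK {n} {d} p (k , i) =
  (updateAt (map inc k) p (λ z → z - + suc (n ℕ.+ d)) , map inc i)

-- Δ^(w_q): w_q loses deg = n+1 grains, every clique vertex (and the sink) gains one;
-- the other w_j are not neighbours.
addΔI : ∀ {n d} → Fin d → Config n d → Config n d
addΔI {n} {d} q (k , i) = (map inc k , updateAt i q (λ z → z - + suc n))

-- They are applied to sorted configurations, for which the first entry
-- of a part (position 0) is a vertex of maximal grain number in that part.
-- (When the part is empty the operator is never meaningfully used; we set it to be the identity.)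
TK : ∀ {n d} → Config n d → Config n d
TK {zero}  u = u
TK {suc n} u = sort (addΔK zero u)

TI : ∀ {n d} → Config n d → Config n d
TI {d = zero}  u = u
TI {d = suc d} u = sort (addΔI zero u)

iter : ∀ {A : Set} → ℕ → (A → A) → A → A
iter zero    f a = a
iter (suc m) f a = f (iter m f a)

TW : ∀ {n d} → Config n d → Config n d
TW {n} {d} u = iter (suc n) TK (iter d TI u)

-- For t ≥ 0 this is w = T_W^t u; for t = -m < 0 (T_W being a bijection on sorted compact
-- configurations), w = T_W^{-m} u means: w is sorted compact and T_W^m w = u.
IsTWPow : ∀ {n d} → ℤ → Config n d → Config n d → Set
IsTWPow (+ m)      u w = w ≡ iter m TW u
IsTWPow -[1+ m ] u w = SortedCompact w × iter (suc m) TW w ≡ u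

_≡TW_ : ∀ {n d} → Config n d → Config n d → Set
u ≡TW v = ∃ λ (t : ℤ) → IsTWPow t v u

weight : ∀ {n} (d : ℕ) → Vec ℤ n → ℤ
weight {n} d k = foldr (λ _ → ℤ) (λ z acc → (z /ℕ suc (n ℕ.+ d)) + acc) (+ 0) k

QSNonNeg : ∀ {n} (d : ℕ) → Vec ℤ n → Set
QSNonNeg {n} d k = ∀ (p : Fin n) → (+ 0 ≤ lookup k p) × (lookup k p ≤ + (n ℕ.+ d))

module Submission where

-- Let n ≥ 1. In a sorted compact configuration the maximal vertex of a part, once toppled, has lost
-- its degree and lies below every other entry of that part (this is what compactness says), so
-- re-sorting merely moves it to the end; every other effect of the toppling is a uniform shift of a
-- whole part. Composing the d topplings in I and the n+1 in K, each entry of I is lowered by n+1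
-- once and raised n+1 times, while the clique is cycled n+1 times and raised n+d+1 times in all:
--   T_W (k₁, …, kₙ ; i) = (k₂, …, kₙ, k₁ − (n+d+1) ; i).
-- Hence T_W fixes I, is injective, maps the sorted compact configurations onto themselves, and
-- lowers the weight Σ ⌊kᵢ / (n+d+1)⌋ by exactly one. A compact clique part lies within n+d+1 below
-- its largest entry, so all floors have the same sign, and the weight vanishes exactly when every
-- floor does, i.e. when 0 ≤ kᵢ ≤ n+d.

open import Defs
open import Data.Nat as ℕ using (ℕ; zero; suc; _≥_; z≤n; s≤s)
import Data.Nat.Properties as ℕ
open import Data.Nat.DivMod using (m<n⇒m/n≡0)
open import Data.Integer as ℤ
  using (ℤ; +_; -[1+_]; _+_; _-_; _*_; -_; _≤_; _<_; _≤?_; _<?_; 0ℤ; 1ℤ; +≤+; _/ℕ_)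
open import Data.Integer.Properties as ℤ using (≤-refl; ≤-trans; ≤-antisym)
open import Data.Integer.DivMod using ([n/ℕd]*d≤n; n<s[n/ℕd]*d; 0≤n⇒0≤n/ℕd)
open import Data.Integer.Tactic.RingSolver using (solve; solve-∀)
open import Data.Fin as Fin using (zero; suc)
open import Data.Fin.Properties using (<-cmp)
import Data.List as L
import Data.List.Properties as L
open import Data.Vec as Vec using (Vec; []; _∷_; _∷ʳ_; map; lookup; toList; initLast)
import Data.Vec.Properties as Vec
open import Data.Vec.Relation.Unary.All as All using (All; []; _∷_)
import Data.Vec.Relation.Unary.All.Properties as All
open import Data.Vec.Relation.Unary.AllPairs as AllPairs using (AllPairs; []; _∷_)
import Data.Vec.Relation.Unary.AllPairs.Properties as AllPairs
open import Data.Product as Prod using (_×_; _,_; proj₁; proj₂; ∃)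
open import Data.Sum using (_⊎_; inj₁; inj₂)
open import Data.Empty using (⊥-elim)
open import Function.Base using (_∘_)
open import Function.Bundles using (_⇔_; mk⇔; Equivalence)
import Function.Properties.Equivalence as ⇔
open import Relation.Binary.Definitions using (tri<; tri≈; tri>)
open import Relation.Binary.PropositionalEquality
open import Relation.Nullary using (yes; no)

private
  variable
    m : ℕ
    A B : Set

-- Integer arithmetic and floor division

≤-via-difference : ∀ {i j k l} → i ≤ j → j - i ≡ l - k → k ≤ l
≤-via-difference i≤j eq = ℤ.0≤i-j⇒j≤i (subst (0ℤ ≤_) eq (ℤ.i≤j⇒0≤j-i i≤j))

<-via-difference : ∀ {i j k l} → i < j → j - i ≡ l - k → k < l
<-via-difference {i} {j} {k} {l} i<j eq = ℤ.suc[i]≤j⇒i<j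
  (≤-via-difference (ℤ.i<j⇒suc[i]≤j i<j)
    (trans (lower j i) (trans (cong (_- + 1) eq) (sym (lower l k)))))
  where
  lower : ∀ a b → a - (+ 1 + b) ≡ (a - b) - + 1
  lower = solve-∀

i<j⇒i≤j-1 : ∀ {i j} → i < j → i ≤ j - 1ℤ
i<j⇒i≤j-1 {i} {j} i<j = ≤-via-difference (ℤ.i<j⇒suc[i]≤j i<j) (rearrange i j)
  where
  rearrange : ∀ a b → b - (+ 1 + a) ≡ (b - + 1) - a
  rearrange = solve-∀

+≡0-nonneg : ∀ {i j} → 0ℤ ≤ i → 0ℤ ≤ j → i + j ≡ 0ℤ → i ≡ 0ℤ × j ≡ 0ℤ
+≡0-nonneg {i} {j} 0≤i 0≤j i+j≡0 =
    ≤-antisym (subst₂ _≤_ (ℤ.+-identityʳ i) i+j≡0 (ℤ.+-monoʳ-≤ i 0≤j)) 0≤i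
  , ≤-antisym (subst₂ _≤_ (ℤ.+-identityˡ j) i+j≡0 (ℤ.+-monoˡ-≤ j 0≤i)) 0≤j

+≡0-nonpos : ∀ {i j} → i ≤ 0ℤ → j ≤ 0ℤ → i + j ≡ 0ℤ → i ≡ 0ℤ × j ≡ 0ℤ
+≡0-nonpos {i} {j} i≤0 j≤0 i+j≡0 =
    ≤-antisym i≤0 (subst₂ _≤_ i+j≡0 (ℤ.+-identityʳ i) (ℤ.+-monoʳ-≤ i j≤0))
  , ≤-antisym j≤0 (subst₂ _≤_ i+j≡0 (ℤ.+-identityˡ j) (ℤ.+-monoˡ-≤ j i≤0))

module _ {D : ℕ} .{{_ : ℕ.NonZero D}} where

  x<q*D⇒x/ℕD<q : ∀ {x q} → x < q * + D → x /ℕ D < q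
  x<q*D⇒x/ℕD<q {x} {q} x<qD =
    ℤ.*-cancelʳ-<-nonNeg {x /ℕ D} {q} (+ D) (ℤ.≤-<-trans ([n/ℕd]*d≤n x D) x<qD)

  q*D≤x⇒q≤x/ℕD : ∀ {x q} → q * + D ≤ x → q ≤ x /ℕ D
  q*D≤x⇒q≤x/ℕD {x} {q} qD≤x = subst (q ≤_) (ℤ.pred-suc (x /ℕ D)) (ℤ.i<j⇒i≤pred[j]
    (ℤ.*-cancelʳ-<-nonNeg {q} {ℤ.suc (x /ℕ D)} (+ D) (ℤ.≤-<-trans qD≤x (n<s[n/ℕd]*d x D))))

  [x-D]/ℕD≡x/ℕD-1 : ∀ x → (x - + D) /ℕ D ≡ x /ℕ D - 1ℤ
  [x-D]/ℕD≡x/ℕD-1 x = ≤-antisym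
    (i<j⇒i≤j-1 {j = x /ℕ D} (x<q*D⇒x/ℕD<q {x - + D}
      (<-via-difference (n<s[n/ℕd]*d x D) (upper (x /ℕ D) x (+ D)))))
    (q*D≤x⇒q≤x/ℕD {x - + D}
      (≤-via-difference ([n/ℕd]*d≤n x D) (lower (x /ℕ D) x (+ D))))
    where
    upper : ∀ q x N → (+ 1 + q) * N - x ≡ q * N - (x - N)
    upper = solve-∀
    lower : ∀ q x N → x - q * N ≡ (x - N) - (q - + 1) * N
    lower = solve-∀

  x<D⇒x/ℕD≤0 : ∀ {x} → x < + D → x /ℕ D ≤ 0ℤ
  x<D⇒x/ℕD≤0 {x} x<D = i<j⇒i≤j-1 {j = 1ℤ}
    (x<q*D⇒x/ℕD<q {x} {1ℤ} (subst (x <_) (sym (ℤ.*-identityˡ (+ D))) x<D))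

x/ℕ[1+m]≡0⇔0≤x≤m : ∀ {m} x → (x /ℕ suc m ≡ 0ℤ) ⇔ (0ℤ ≤ x × x ≤ + m)
x/ℕ[1+m]≡0⇔0≤x≤m {m} x = mk⇔ to from
  where
  to : x /ℕ suc m ≡ 0ℤ → 0ℤ ≤ x × x ≤ + m
  to floor≡0 =
      subst (λ q → q * + suc m ≤ x) floor≡0 ([n/ℕd]*d≤n x (suc m))
    , i<j⇒i≤j-1 {j = + suc m} (subst (x <_) (ℤ.*-identityˡ (+ suc m))
        (subst (λ q → x < ℤ.suc q * + suc m) floor≡0 (n<s[n/ℕd]*d x (suc m))))
  from : 0ℤ ≤ x × x ≤ + m → x /ℕ suc m ≡ 0ℤ
  from (+≤+ _ , +≤+ x≤m) = cong +_ (m<n⇒m/n≡0 (s≤s x≤m))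

iter-natural : ∀ {f : A → A} {g : B → B} (h : A → B) → (∀ x → h (f x) ≡ g (h x)) →
               ∀ j x → h (iter j f x) ≡ iter j g (h x)
iter-natural         h comm zero    x = refl
iter-natural {g = g} h comm (suc j) x = trans (comm _) (cong g (iter-natural h comm j x))

iter-sucʳ : ∀ (f : A → A) j x → iter (suc j) f x ≡ iter j f (f x)
iter-sucʳ f = iter-natural f (λ _ → refl)

iter-preserves : ∀ {P : A → Set} {f : A → A} → (∀ x → P x → P (f x)) →
                 ∀ j x → P x → P (iter j f x)
iter-preserves pres zero    x px = px
iter-preserves pres (suc j) x px = pres _ (iter-preserves pres j x px)

iter-cong-on : ∀ {P : A → Set} {f g : A → A} → (∀ x → P x → f x ≡ g x) →
               (∀ x → P x → P (g x)) → ∀ j x → P x → iter j f x ≡ iter j g x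
iter-cong-on         f≡g pres zero    x px = refl
iter-cong-on {f = f} f≡g pres (suc j) x px =
  trans (cong f (iter-cong-on f≡g pres j x px)) (f≡g _ (iter-preserves pres j x px))

iter-injective : ∀ {f : A → A} → (∀ {x y} → f x ≡ f y → x ≡ y) →
                 ∀ j {x y} → iter j f x ≡ iter j f y → x ≡ y
iter-injective         inj zero            eq = eq
iter-injective {f = f} inj (suc j) {x} {y} eq =
  iter-injective inj j (inj {iter j f x} {iter j f y} eq)

iter-∘ : ∀ {f g : A → A} → (∀ x → f (g x) ≡ g (f x)) →
         ∀ j x → iter j (f ∘ g) x ≡ iter j f (iter j g x)
iter-∘             comm zero    x = refl
iter-∘ {f = f} {g} comm (suc j) x =
  trans (cong (f ∘ g) (iter-∘ comm j x)) (cong f (iter-natural g (sym ∘ comm) j (iter j g x)))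

iter-map-× : ∀ {f : A → A} {g : B → B} j p →
             iter j (Prod.map f g) p ≡ Prod.map (iter j f) (iter j g) p
iter-map-×             zero    p = refl
iter-map-× {f = f} {g} (suc j) p = cong (Prod.map f g) (iter-map-× j p)

iter-map₁ : ∀ {f : A → A} j (p : A × B) → iter j (Prod.map₁ f) p ≡ Prod.map₁ (iter j f) p
iter-map₁         zero    p = refl
iter-map₁ {f = f} (suc j) p = cong (Prod.map₁ f) (iter-map₁ j p)

-- Rotations of integer vectors

raise : ℤ → Vec ℤ m → Vec ℤ m
raise a = map (_+ a)

rotate : ℤ → Vec ℤ m → Vec ℤ m
rotate c []       = []
rotate c (x ∷ xs) = xs ∷ʳ (x - c)

raise-identity : (v : Vec ℤ m) → raise 0ℤ v ≡ v
raise-identity v = trans (Vec.map-cong ℤ.+-identityʳ v) (Vec.map-id v)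

raise-raise : ∀ a b (v : Vec ℤ m) → raise a (raise b v) ≡ raise (b + a) v
raise-raise a b v =
  trans (sym (Vec.map-∘ (_+ a) (_+ b) v)) (Vec.map-cong (λ z → ℤ.+-assoc z b a) v)

iter-raise : ∀ j (v : Vec ℤ m) → iter j (raise 1ℤ) v ≡ raise (+ j) v
iter-raise zero    v = sym (raise-identity v)
iter-raise (suc j) v = begin
  raise 1ℤ (iter j (raise 1ℤ) v) ≡⟨ cong (raise 1ℤ) (iter-raise j v) ⟩
  raise 1ℤ (raise (+ j) v)       ≡⟨ raise-raise 1ℤ (+ j) v ⟩
  raise (+ (j ℕ.+ 1)) v          ≡⟨ cong (λ k → raise (+ k) v) (ℕ.+-comm j 1) ⟩
  raise (+ suc j) v              ∎
  where open ≡-Reasoning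

rotate-raise : ∀ c a (v : Vec ℤ m) → rotate c (raise a v) ≡ raise a (rotate c v)
rotate-raise c a []       = refl
rotate-raise c a (x ∷ xs) =
  trans (cong (raise a xs ∷ʳ_) (swap x a c)) (sym (Vec.map-∷ʳ (_+ a) (x - c) xs))
  where
  swap : ∀ x a c → (x + a) - c ≡ (x - c) + a
  swap = solve-∀

rotate-injective : ∀ c {v w : Vec ℤ m} → rotate c v ≡ rotate c w → v ≡ w
rotate-injective c {[]}     {[]}     _  = refl
rotate-injective c {x ∷ xs} {y ∷ ys} eq = cong₂ _∷_ x≡y (Vec.∷ʳ-injectiveˡ xs ys eq)
  where
  open ≡-Reasoning
  x≡y : x ≡ y
  x≡y = begin
    x           ≡⟨ solve (x L.∷ c L.∷ L.[]) ⟩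
    (x - c) + c ≡⟨ cong (_+ c) (Vec.∷ʳ-injectiveʳ xs ys eq) ⟩
    (y - c) + c ≡⟨ solve (y L.∷ c L.∷ L.[]) ⟩
    y           ∎

-- The list version lets iter-rotateᴸ generalise over ys ++ zs, whose vector form would have
-- length j + k on one side and k + j on the other.
rotateᴸ : ℤ → L.List ℤ → L.List ℤ
rotateᴸ c L.[]       = L.[]
rotateᴸ c (x L.∷ xs) = xs L.∷ʳ (x - c)

toList-rotate : ∀ c (v : Vec ℤ m) → toList (rotate c v) ≡ rotateᴸ c (toList v)
toList-rotate c []       = refl
toList-rotate c (x ∷ xs) = Vec.toList-∷ʳ (x - c) xs

iter-rotateᴸ : ∀ c ys zs →
               iter (L.length ys) (rotateᴸ c) (ys L.++ zs) ≡ zs L.++ L.map (_- c) ys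
iter-rotateᴸ c L.[]       zs = sym (L.++-identityʳ zs)
iter-rotateᴸ c (y L.∷ ys) zs = begin
  iter (suc (L.length ys)) (rotateᴸ c) (y L.∷ ys L.++ zs)
    ≡⟨ iter-sucʳ (rotateᴸ c) (L.length ys) _ ⟩
  iter (L.length ys) (rotateᴸ c) ((ys L.++ zs) L.∷ʳ (y - c))
    ≡⟨ cong (iter (L.length ys) (rotateᴸ c)) (L.++-assoc ys zs L.[ y - c ]) ⟩
  iter (L.length ys) (rotateᴸ c) (ys L.++ (zs L.∷ʳ (y - c)))
    ≡⟨ iter-rotateᴸ c ys (zs L.∷ʳ (y - c)) ⟩
  (zs L.∷ʳ (y - c)) L.++ L.map (_- c) ys
    ≡⟨ L.++-assoc zs L.[ y - c ] (L.map (_- c) ys) ⟩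
  zs L.++ L.map (_- c) (y L.∷ ys) ∎
  where open ≡-Reasoning

iter-rotate-length : ∀ c (v : Vec ℤ m) → iter m (rotate c) v ≡ raise (- c) v
iter-rotate-length {m} c v =
  trans (sym (Vec.cast-is-id refl _)) (Vec.toList-injective refl _ _ (begin
  toList (iter m (rotate c) v)
    ≡⟨ iter-natural toList (toList-rotate c) m v ⟩
  iter m (rotateᴸ c) (toList v)
    ≡⟨ cong (λ j → iter j (rotateᴸ c) (toList v)) (sym (Vec.length-toList v)) ⟩
  iter |v| (rotateᴸ c) (toList v)
    ≡⟨ cong (iter |v| (rotateᴸ c)) (sym (L.++-identityʳ (toList v))) ⟩
  iter |v| (rotateᴸ c) (toList v L.++ L.[])
    ≡⟨ iter-rotateᴸ c (toList v) L.[] ⟩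
  L.map (_- c) (toList v)
    ≡⟨ Vec.toList-map (_- c) v ⟨
  toList (raise (- c) v) ∎))
  where
  open ≡-Reasoning
  |v| = L.length (toList v)

-- weight d k unfolds to floorSum (suc (n + d)) k; fixing the divisor makes the sum structurally
-- recursive in the vector.
floorSum : (D : ℕ) .{{_ : ℕ.NonZero D}} → Vec ℤ m → ℤ
floorSum D = Vec.foldr (λ _ → ℤ) (λ z s → z /ℕ D + s) 0ℤ

module _ {D : ℕ} .{{_ : ℕ.NonZero D}} where

  floorSum-∷ʳ : ∀ a (xs : Vec ℤ m) → floorSum D (xs ∷ʳ a) ≡ floorSum D xs + a /ℕ D
  floorSum-∷ʳ a []       = ℤ.+-comm (a /ℕ D) 0ℤ
  floorSum-∷ʳ a (x ∷ xs) =
    trans (cong (λ s → x /ℕ D + s) (floorSum-∷ʳ a xs)) (sym (ℤ.+-assoc (x /ℕ D) _ _))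

  floorSum-rotate : (v : Vec ℤ (suc m)) → floorSum D (rotate (+ D) v) ≡ floorSum D v - 1ℤ
  floorSum-rotate (x ∷ xs) = begin
    floorSum D (xs ∷ʳ (x - + D))   ≡⟨ floorSum-∷ʳ (x - + D) xs ⟩
    floorSum D xs + (x - + D) /ℕ D ≡⟨ cong (λ q → floorSum D xs + q) ([x-D]/ℕD≡x/ℕD-1 x) ⟩
    floorSum D xs + (x /ℕ D - 1ℤ)  ≡⟨ swap (floorSum D xs) (x /ℕ D) ⟩
    (x /ℕ D + floorSum D xs) - 1ℤ  ∎
    where
    open ≡-Reasoning
    swap : ∀ s q → s + (q - + 1) ≡ (q + s) - + 1
    swap = solve-∀

  floorSum-iter-rotate : ∀ j (v : Vec ℤ (suc m)) →
                         floorSum D (iter j (rotate (+ D)) v) ≡ floorSum D v - + j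
  floorSum-iter-rotate zero    v = sym (ℤ.+-identityʳ (floorSum D v))
  floorSum-iter-rotate (suc j) v = begin
    floorSum D (rotate (+ D) (iter j (rotate (+ D)) v))
      ≡⟨ floorSum-rotate (iter j (rotate (+ D)) v) ⟩
    floorSum D (iter j (rotate (+ D)) v) - 1ℤ
      ≡⟨ cong (_- 1ℤ) (floorSum-iter-rotate j v) ⟩
    (floorSum D v - + j) - 1ℤ
      ≡⟨ regroup (floorSum D v) (+ j) ⟩
    floorSum D v - + suc j ∎
    where
    open ≡-Reasoning
    regroup : ∀ s J → (s - J) - + 1 ≡ s - (+ 1 + J)
    regroup = solve-∀

  Floors≡0 : Vec ℤ m → Set
  Floors≡0 = All (λ z → z /ℕ D ≡ 0ℤ)

  floors≡0⇒floorSum≡0 : {v : Vec ℤ m} → Floors≡0 v → floorSum D v ≡ 0ℤ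
  floors≡0⇒floorSum≡0 []                = refl
  floors≡0⇒floorSum≡0 (x/D≡0 ∷ xs/D≡0) = cong₂ _+_ x/D≡0 (floors≡0⇒floorSum≡0 xs/D≡0)

  floorSum-nonneg : {v : Vec ℤ m} → All (λ z → 0ℤ ≤ z /ℕ D) v → 0ℤ ≤ floorSum D v
  floorSum-nonneg []         = ≤-refl
  floorSum-nonneg (px ∷ pxs) = ℤ.+-mono-≤ px (floorSum-nonneg pxs)

  floorSum-nonpos : {v : Vec ℤ m} → All (λ z → z /ℕ D ≤ 0ℤ) v → floorSum D v ≤ 0ℤ
  floorSum-nonpos []         = ≤-refl
  floorSum-nonpos (px ∷ pxs) = ℤ.+-mono-≤ px (floorSum-nonpos pxs)

  floorSum≡0⇒floors≡0-nonneg : {v : Vec ℤ m} → All (λ z → 0ℤ ≤ z /ℕ D) v →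
                               floorSum D v ≡ 0ℤ → Floors≡0 v
  floorSum≡0⇒floors≡0-nonneg []         _  = []
  floorSum≡0⇒floors≡0-nonneg (px ∷ pxs) eq =
    let x/D≡0 , rest≡0 = +≡0-nonneg px (floorSum-nonneg pxs) eq
    in x/D≡0 ∷ floorSum≡0⇒floors≡0-nonneg pxs rest≡0

  floorSum≡0⇒floors≡0-nonpos : {v : Vec ℤ m} → All (λ z → z /ℕ D ≤ 0ℤ) v →
                               floorSum D v ≡ 0ℤ → Floors≡0 v
  floorSum≡0⇒floors≡0-nonpos []         _  = []
  floorSum≡0⇒floors≡0-nonpos (px ∷ pxs) eq =
    let x/D≡0 , rest≡0 = +≡0-nonpos px (floorSum-nonpos pxs) eq
    in x/D≡0 ∷ floorSum≡0⇒floors≡0-nonpos pxs rest≡0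

-- Windows

All-∷ʳ⁺ : ∀ {P : A → Set} {a} {xs : Vec A m} → All P xs → P a → All P (xs ∷ʳ a)
All-∷ʳ⁺ []         pa = pa ∷ []
All-∷ʳ⁺ (px ∷ pxs) pa = px ∷ All-∷ʳ⁺ pxs pa

All-∷ʳ⁻ : ∀ {P : A → Set} {a} (xs : Vec A m) → All P (xs ∷ʳ a) → All P xs × P a
All-∷ʳ⁻ []       (pa ∷ [])  = [] , pa
All-∷ʳ⁻ (x ∷ xs) (px ∷ pxs) = Prod.map₁ (px ∷_) (All-∷ʳ⁻ xs pxs)

module _ {R : A → A → Set} where

  AllPairs-∷ʳ⁺ : ∀ {a} {xs : Vec A m} → AllPairs R xs → All (λ y → R y a) xs →
                 AllPairs R (xs ∷ʳ a)
  AllPairs-∷ʳ⁺ []         []       = [] ∷ []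
  AllPairs-∷ʳ⁺ (px ∷ pxs) (r ∷ rs) = All-∷ʳ⁺ px r ∷ AllPairs-∷ʳ⁺ pxs rs

  AllPairs-∷ʳ⁻ : ∀ {a} (xs : Vec A m) → AllPairs R (xs ∷ʳ a) →
                 AllPairs R xs × All (λ y → R y a) xs
  AllPairs-∷ʳ⁻ []       _          = [] , []
  AllPairs-∷ʳ⁻ (x ∷ xs) (px ∷ pxs) =
    let px′ , r = All-∷ʳ⁻ xs px ; pxs′ , rs = AllPairs-∷ʳ⁻ xs pxs
    in px′ ∷ pxs′ , r ∷ rs

  AllPairs⇒lookup : {xs : Vec A m} → AllPairs R xs →
                    ∀ {i j} → i Fin.< j → R (lookup xs i) (lookup xs j)
  AllPairs⇒lookup (px ∷ pxs) {zero}  {suc j} _         = All.lookup⁺ px j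
  AllPairs⇒lookup (px ∷ pxs) {suc i} {suc j} (s≤s i<j) = AllPairs⇒lookup pxs i<j

  lookup⇒AllPairs : (xs : Vec A m) →
                    (∀ {i j} → i Fin.< j → R (lookup xs i) (lookup xs j)) → AllPairs R xs
  lookup⇒AllPairs []       _ = []
  lookup⇒AllPairs (x ∷ xs) r =
    All.lookup⁻ (λ j → r {zero} {suc j} (s≤s z≤n)) ∷ lookup⇒AllPairs xs (λ i<j → r (s≤s i<j))

Within : ℤ → ℤ → ℤ → Set
Within c x y = y ≤ x × x - y ≤ c

Window : ℤ → Vec ℤ m → Set
Window c = AllPairs (Within c)

within-raise : ∀ {c x y} a → Within c x y → Within c (x + a) (y + a)
within-raise {c} {x} {y} a (y≤x , x-y≤c) =
  ℤ.+-monoˡ-≤ a y≤x , ≤-via-difference x-y≤c (solve (x L.∷ y L.∷ a L.∷ c L.∷ L.[]))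

within-rotate : ∀ {c x y} → Within c x y → Within c y (x - c)
within-rotate {c} {x} {y} (y≤x , x-y≤c) =
  ≤-via-difference x-y≤c (solve (x L.∷ y L.∷ c L.∷ L.[])) ,
  ≤-via-difference y≤x (solve (x L.∷ y L.∷ c L.∷ L.[]))

within-unrotate : ∀ {c y a} → Within c y a → Within c (a + c) y
within-unrotate {c} {y} {a} (a≤y , y-a≤c) =
  ≤-via-difference y-a≤c (solve (y L.∷ a L.∷ c L.∷ L.[])) ,
  ≤-via-difference a≤y (solve (y L.∷ a L.∷ c L.∷ L.[]))

Window⇒descending : ∀ {c} {v : Vec ℤ m} → Window c v → AllPairs ℤ._≥_ v
Window⇒descending = AllPairs.map proj₁

Window-raise : ∀ {c} a {v : Vec ℤ m} → Window c v → Window c (raise a v)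
Window-raise a W = AllPairs.map⁺ (AllPairs.map (within-raise a) W)

Window-rotate : ∀ {c} {v : Vec ℤ m} → Window c v → Window c (rotate c v)
Window-rotate []      = []
Window-rotate (w ∷ W) = AllPairs-∷ʳ⁺ W (All.map within-rotate w)

rotate-onto-Window : ∀ {c} {v : Vec ℤ (suc m)} → Window c v →
                     ∃ λ w → Window c w × rotate c w ≡ v
rotate-onto-Window {c = c} {v} W with initLast v
... | ys , a , refl =
  let Wys , ys≥a = AllPairs-∷ʳ⁻ ys W
  in (a + c) ∷ ys , All.map within-unrotate ys≥a ∷ Wys , cong (ys ∷ʳ_) (solve (a L.∷ c L.∷ L.[]))

iter-rotate-onto-Window : ∀ {c} j {v : Vec ℤ (suc m)} → Window c v →
                          ∃ λ w → Window c w × iter j (rotate c) w ≡ v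
iter-rotate-onto-Window         zero    W = _ , W , refl
iter-rotate-onto-Window {c = c} (suc j) W =
  let w₁ , W₁ , e₁ = iter-rotate-onto-Window j W
      w , Ww , e = rotate-onto-Window W₁
  in w , Ww , trans (iter-sucʳ (rotate c) j w) (trans (cong (iter j (rotate c)) e) e₁)

module _ {D : ℕ} .{{_ : ℕ.NonZero D}} where

  Window-floors-sign : {v : Vec ℤ m} → Window (+ D) v →
                       All (λ z → z /ℕ D ≤ 0ℤ) v ⊎ All (λ z → 0ℤ ≤ z /ℕ D) v
  Window-floors-sign []                  = inj₁ []
  Window-floors-sign {v = x ∷ _} (w ∷ _) with x <? + D
  ... | yes x<D =
    inj₁ (x<D⇒x/ℕD≤0 x<D ∷ All.map (λ (y≤x , _) → x<D⇒x/ℕD≤0 (ℤ.≤-<-trans y≤x x<D)) w)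
  ... | no x≮D  =
    inj₂ (0≤n⇒0≤n/ℕd x D 0≤x ∷ All.map (λ {y} (_ , x-y≤D) → 0≤n⇒0≤n/ℕd y D (0≤y x-y≤D)) w)
    where
    D≤x : + D ≤ x
    D≤x = ℤ.≮⇒≥ x≮D
    0≤x : 0ℤ ≤ x
    0≤x = ≤-trans (+≤+ z≤n) D≤x
    0≤y : ∀ {y} → x - y ≤ + D → 0ℤ ≤ y
    0≤y {y} x-y≤D = ≤-via-difference (ℤ.+-mono-≤ x-y≤D D≤x) (cancel x y (+ D))
      where
      cancel : ∀ x y N → (N + x) - ((x - y) + N) ≡ y - 0ℤ
      cancel = solve-∀

  floorSum≡0⇔floors≡0 : {v : Vec ℤ m} → Window (+ D) v → (floorSum D v ≡ 0ℤ) ⇔ Floors≡0 v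
  floorSum≡0⇔floors≡0 {v = v} W = mk⇔ to floors≡0⇒floorSum≡0
    where
    to : floorSum D v ≡ 0ℤ → Floors≡0 v
    to with Window-floors-sign W
    ... | inj₁ nonpos = floorSum≡0⇒floors≡0-nonpos nonpos
    ... | inj₂ nonneg = floorSum≡0⇒floors≡0-nonneg nonneg

sorted×spread⇒Window : ∀ {b} {v : Vec ℤ m} → SortedVec v → Spread≤ v b → Window (+ b) v
sorted×spread⇒Window {v = v} sorted spread =
  lookup⇒AllPairs v (λ {i} {j} i<j → sorted i j (ℕ.<⇒≤ i<j) , spread i j)

Window⇒sorted : ∀ {c} {v : Vec ℤ m} → Window c v → SortedVec v
Window⇒sorted W i j i≤j with <-cmp i j
... | tri< i<j _ _  = proj₁ (AllPairs⇒lookup W i<j)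
... | tri≈ _ refl _ = ≤-refl
... | tri> _ _ j<i  = ⊥-elim (ℕ.<⇒≱ j<i i≤j)

Window⇒spread : ∀ {b} {v : Vec ℤ m} → Window (+ b) v → Spread≤ v b
Window⇒spread {v = v} W i j with <-cmp i j
... | tri< i<j _ _  = proj₂ (AllPairs⇒lookup W i<j)
... | tri≈ _ refl _ = subst (_≤ _) (sym (ℤ.+-inverseʳ (lookup v i))) (+≤+ z≤n)
... | tri> _ _ j<i  = ≤-trans (ℤ.i≤j⇒i-j≤0 (proj₁ (AllPairs⇒lookup W j<i))) (+≤+ z≤n)

WindowConfig : ∀ {n d} → Config n d → Set
WindowConfig {n} {d} (k , i) = Window (+ suc (n ℕ.+ d)) k × Window (+ suc n) i

SortedCompact⇒WindowConfig : ∀ {n d} {u : Config n d} → SortedCompact u → WindowConfig u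
SortedCompact⇒WindowConfig ((sk , si) , (ck , ci)) =
  sorted×spread⇒Window sk ck , sorted×spread⇒Window si ci

WindowConfig⇒SortedCompact : ∀ {n d} {u : Config n d} → WindowConfig u → SortedCompact u
WindowConfig⇒SortedCompact (Wk , Wi) =
  (Window⇒sorted Wk , Window⇒sorted Wi) , (Window⇒spread Wk , Window⇒spread Wi)

QSNonNeg⇔floors≡0 : ∀ {n} d (k : Vec ℤ n) → QSNonNeg d k ⇔ Floors≡0 {D = suc (n ℕ.+ d)} k
QSNonNeg⇔floors≡0 d k = mk⇔
  (λ qs → All.lookup⁻ (λ p → Equivalence.from (x/ℕ[1+m]≡0⇔0≤x≤m _) (qs p)))
  (λ floors p → Equivalence.to (x/ℕ[1+m]≡0⇔0≤x≤m _) (All.lookup⁺ floors p))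

QSNonNeg⇔weight≡0 : ∀ {n} d {k : Vec ℤ n} → Window (+ suc (n ℕ.+ d)) k →
                    QSNonNeg d k ⇔ (weight d k ≡ 0ℤ)
QSNonNeg⇔weight≡0 d {k} W = ⇔.trans (QSNonNeg⇔floors≡0 d k) (⇔.sym (floorSum≡0⇔floors≡0 W))

insertDesc-max : ∀ {x} {xs : Vec ℤ m} → All (_≤ x) xs → insertDesc x xs ≡ x ∷ xs
insertDesc-max                  []        = refl
insertDesc-max {x = x} {y ∷ _} (y≤x ∷ _) with y ≤? x
... | yes _  = refl
... | no y≰x = ⊥-elim (y≰x y≤x)

sortVec-descending : {xs : Vec ℤ m} → AllPairs ℤ._≥_ xs → sortVec xs ≡ xs
sortVec-descending []                         = refl
sortVec-descending {xs = x ∷ xs} (x≥xs ∷ D) =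
  trans (cong (insertDesc x) (sortVec-descending D)) (insertDesc-max x≥xs)

constant-∷≡∷ʳ : ∀ {a} {ys : Vec ℤ m} → All (_≡ a) ys → a ∷ ys ≡ ys ∷ʳ a
constant-∷≡∷ʳ []           = refl
constant-∷≡∷ʳ (refl ∷ eqs) = cong (_ ∷_) (constant-∷≡∷ʳ eqs)

insertDesc-min : ∀ {a} {ys : Vec ℤ m} → AllPairs ℤ._≥_ ys → All (a ≤_) ys →
                 insertDesc a ys ≡ ys ∷ʳ a
insertDesc-min []                                    []            = refl
insertDesc-min {a = a} {y ∷ ys} (y≥ys ∷ D) (a≤y ∷ a≤ys) with y ≤? a
... | no _    = cong (y ∷_) (insertDesc-min D a≤ys)
... | yes y≤a with ≤-antisym y≤a a≤y
...   | refl  =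
  cong (a ∷_) (constant-∷≡∷ʳ (All.map (λ (z≤a , a≤z) → ≤-antisym z≤a a≤z) (All.zip (y≥ys , a≤ys))))

sortVec-∷-min : ∀ {a} {ys : Vec ℤ m} → AllPairs ℤ._≥_ ys → All (a ≤_) ys →
                sortVec (a ∷ ys) ≡ ys ∷ʳ a
sortVec-∷-min {a = a} D a≤ys =
  trans (cong (insertDesc a) (sortVec-descending D)) (insertDesc-min D a≤ys)

-- Toppling

TKᵂ : ∀ {n d} → Config (suc n) d → Config (suc n) d
TKᵂ {n} {d} = Prod.map (raise 1ℤ ∘ rotate (+ suc (suc n ℕ.+ d))) (raise 1ℤ)

TIᵂ : ∀ {n d} → Config n d → Config n d
TIᵂ {n} = Prod.map (raise 1ℤ) (rotate (+ suc n))

TWᵂ : ∀ {n d} → Config n d → Config n d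
TWᵂ {n} {d} = Prod.map₁ (rotate (+ suc (n ℕ.+ d)))

TKᵂ-Window : ∀ {n d} (u : Config (suc n) d) → WindowConfig u → WindowConfig (TKᵂ u)
TKᵂ-Window _ = Prod.map (Window-raise 1ℤ ∘ Window-rotate) (Window-raise 1ℤ)

TIᵂ-Window : ∀ {n d} (u : Config n d) → WindowConfig u → WindowConfig (TIᵂ u)
TIᵂ-Window _ = Prod.map (Window-raise 1ℤ) Window-rotate

TWᵂ-Window : ∀ {n d} (u : Config n d) → WindowConfig u → WindowConfig (TWᵂ u)
TWᵂ-Window _ = Prod.map₁ Window-rotate

TK≡TKᵂ : ∀ {n d} (u : Config (suc n) d) → WindowConfig u → TK u ≡ TKᵂ u
TK≡TKᵂ {n} {d} (x ∷ xs , i) (x≥xs ∷ Wxs , Wi) = cong₂ _,_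
  (begin
    sortVec (((x + 1ℤ) - D) ∷ raise 1ℤ xs)
      ≡⟨ sortVec-∷-min (Window⇒descending (Window-raise 1ℤ Wxs))
                       (All.map⁺ (All.map lower x≥xs)) ⟩
    raise 1ℤ xs ∷ʳ ((x + 1ℤ) - D)
      ≡⟨ cong (raise 1ℤ xs ∷ʳ_) (toppled x D) ⟩
    raise 1ℤ xs ∷ʳ ((x - D) + 1ℤ)
      ≡⟨ Vec.map-∷ʳ (_+ 1ℤ) (x - D) xs ⟨
    raise 1ℤ (xs ∷ʳ (x - D)) ∎)
  (sortVec-descending (Window⇒descending (Window-raise 1ℤ Wi)))
  where
  open ≡-Reasoning
  D = + suc (suc n ℕ.+ d)
  toppled : ∀ x c → (x + + 1) - c ≡ (x - c) + + 1
  toppled = solve-∀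
  lower : ∀ {y} → Within D x y → (x + 1ℤ) - D ≤ y + 1ℤ
  lower w = subst (_≤ _) (sym (toppled x D)) (ℤ.+-monoˡ-≤ 1ℤ (proj₁ (within-rotate w)))

TI≡TIᵂ : ∀ {n d} (u : Config n (suc d)) → WindowConfig u → TI u ≡ TIᵂ u
TI≡TIᵂ (k , x ∷ xs) (Wk , x≥xs ∷ Wxs) = cong₂ _,_
  (sortVec-descending (Window⇒descending (Window-raise 1ℤ Wk)))
  (sortVec-∷-min (Window⇒descending Wxs) (All.map (proj₁ ∘ within-rotate) x≥xs))

iter-TI≡iter-TIᵂ : ∀ {n d} (u : Config n d) → WindowConfig u → iter d TI u ≡ iter d TIᵂ u
iter-TI≡iter-TIᵂ {d = zero}  u W = refl
iter-TI≡iter-TIᵂ {d = suc d} u W = iter-cong-on TI≡TIᵂ TIᵂ-Window (suc d) u W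

iter-TIᵂ : ∀ {n d} (u : Config n d) →
           iter d TIᵂ u ≡ (raise (+ d) (clique u) , raise (- + suc n) (indep u))
iter-TIᵂ {n} {d} (k , i) =
  trans (iter-map-× {f = raise 1ℤ} {rotate (+ suc n)} d (k , i))
        (cong₂ _,_ (iter-raise d k) (iter-rotate-length (+ suc n) i))

iter-TKᵂ : ∀ {n d} (u : Config (suc n) d) → let C = + suc (suc n) ; D = + suc (suc n ℕ.+ d) in
           iter (suc (suc n)) TKᵂ u
             ≡ (raise C (rotate D (raise (- D) (clique u))) , raise C (indep u))
iter-TKᵂ {n} {d} (k , i) =
  trans (iter-map-× {f = raise 1ℤ ∘ rotate D} {raise 1ℤ} (suc (suc n)) (k , i))
        (cong₂ _,_ clique-part (iter-raise (suc (suc n)) i))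
  where
  open ≡-Reasoning
  D = + suc (suc n ℕ.+ d)
  clique-part : iter (suc (suc n)) (raise 1ℤ ∘ rotate D) k
                  ≡ raise (+ suc (suc n)) (rotate D (raise (- D) k))
  clique-part = begin
    iter (suc (suc n)) (raise 1ℤ ∘ rotate D) k
      ≡⟨ iter-∘ {f = raise 1ℤ} {rotate D} (λ v → sym (rotate-raise D 1ℤ v)) (suc (suc n)) k ⟩
    iter (suc (suc n)) (raise 1ℤ) (rotate D (iter (suc n) (rotate D) k))
      ≡⟨ iter-raise (suc (suc n)) (rotate D (iter (suc n) (rotate D) k)) ⟩
    raise (+ suc (suc n)) (rotate D (iter (suc n) (rotate D) k))
      ≡⟨ cong (raise (+ suc (suc n)) ∘ rotate D) (iter-rotate-length D k) ⟩
    raise (+ suc (suc n)) (rotate D (raise (- D) k)) ∎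

raise-rotate-raise : ∀ c e (v : Vec ℤ m) →
                     raise c (rotate (c + e) (raise (- (c + e)) (raise e v))) ≡ rotate (c + e) v
raise-rotate-raise c e v = begin
  raise c (rotate D (raise (- D) (raise e v))) ≡⟨ rotate-raise D c (raise (- D) (raise e v)) ⟨
  rotate D (raise c (raise (- D) (raise e v))) ≡⟨ cong (rotate D) (raise-raise c (- D) (raise e v)) ⟩
  rotate D (raise (- D + c) (raise e v))       ≡⟨ cong (rotate D) (raise-raise (- D + c) e v) ⟩
  rotate D (raise (e + (- D + c)) v)           ≡⟨ cong (λ a → rotate D (raise a v)) (cancel c e) ⟩
  rotate D (raise 0ℤ v)                        ≡⟨ cong (rotate D) (raise-identity v) ⟩
  rotate D v                                   ∎
  where
  open ≡-Reasoning
  D = c + e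
  cancel : ∀ c e → e + (- (c + e) + c) ≡ 0ℤ
  cancel = solve-∀

TW≡TWᵂ : ∀ {n d} (u : Config (suc n) d) → WindowConfig u → TW u ≡ TWᵂ u
TW≡TWᵂ {n} {d} (k , i) W = begin
  iter (suc (suc n)) TK (iter d TI (k , i))
    ≡⟨ cong (iter (suc (suc n)) TK) (iter-TI≡iter-TIᵂ (k , i) W) ⟩
  iter (suc (suc n)) TK (iter d TIᵂ (k , i))
    ≡⟨ iter-cong-on TK≡TKᵂ TKᵂ-Window (suc (suc n)) _ (iter-preserves TIᵂ-Window d (k , i) W) ⟩
  iter (suc (suc n)) TKᵂ (iter d TIᵂ (k , i))
    ≡⟨ cong (iter (suc (suc n)) TKᵂ) (iter-TIᵂ (k , i)) ⟩
  iter (suc (suc n)) TKᵂ (raise (+ d) k , raise (- C) i)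
    ≡⟨ iter-TKᵂ (raise (+ d) k , raise (- C) i) ⟩
  (raise C (rotate D (raise (- D) (raise (+ d) k))) , raise C (raise (- C) i))
    ≡⟨ cong₂ _,_ (subst (λ D → raise C (rotate D (raise (- D) (raise (+ d) k))) ≡ rotate D k)
                        (sym (ℤ.pos-+ (suc (suc n)) d)) (raise-rotate-raise C (+ d) k))
                 indep-part ⟩
  (rotate D k , i) ∎
  where
  open ≡-Reasoning
  C = + suc (suc n)
  D = + suc (suc n ℕ.+ d)
  indep-part : raise C (raise (- C) i) ≡ i
  indep-part = trans (raise-raise C (- C) i)
                     (trans (cong (λ a → raise a i) (ℤ.+-inverseˡ C)) (raise-identity i))

TW-Window : ∀ {n d} (u : Config (suc n) d) → WindowConfig u → WindowConfig (TW u)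
TW-Window u W = subst WindowConfig (sym (TW≡TWᵂ u W)) (TWᵂ-Window u W)

iter-TW : ∀ {n d} (u : Config (suc n) d) → WindowConfig u → ∀ j →
          iter j TW u ≡ (iter j (rotate (+ suc (suc n ℕ.+ d))) (clique u) , indep u)
iter-TW u W j = trans (iter-cong-on TW≡TWᵂ TWᵂ-Window j u W) (iter-map₁ j u)

weight-iter-TW : ∀ {n d} (u : Config (suc n) d) → WindowConfig u → ∀ j →
                 weight d (clique (iter j TW u)) ≡ weight d (clique u) - + j
weight-iter-TW {d = d} u W j =
  trans (cong (weight d ∘ proj₁) (iter-TW u W j)) (floorSum-iter-rotate j (clique u))

module _ {n d : ℕ} {u : Config (suc n) d} (W : WindowConfig u) where

  IsTWPow⇒Window : ∀ t {w} → IsTWPow t u w → WindowConfig w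
  IsTWPow⇒Window (+ m)     refl     = iter-preserves TW-Window m u W
  IsTWPow⇒Window -[1+ m ] (sc , _) = SortedCompact⇒WindowConfig sc

  IsTWPow⇒indep : ∀ t {w} → IsTWPow t u w → indep w ≡ indep u
  IsTWPow⇒indep (+ m)          refl     = cong proj₂ (iter-TW u W m)
  IsTWPow⇒indep -[1+ m ] {w} (sc , e) =
    trans (sym (cong proj₂ (iter-TW w (SortedCompact⇒WindowConfig sc) (suc m)))) (cong indep e)

  IsTWPow⇒weight : ∀ t {w} → IsTWPow t u w → weight d (clique w) ≡ weight d (clique u) - t
  IsTWPow⇒weight (+ m)          refl     = weight-iter-TW u W m
  IsTWPow⇒weight -[1+ m ] {w} (sc , e) = begin
    weight d (clique w)
      ≡⟨ cancel (weight d (clique w)) (+ suc m) ⟨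
    (weight d (clique w) - + suc m) + + suc m
      ≡⟨ cong (_+ + suc m) (weight-iter-TW w (SortedCompact⇒WindowConfig sc) (suc m)) ⟨
    weight d (clique (iter (suc m) TW w)) + + suc m
      ≡⟨ cong (λ v → weight d (clique v) + + suc m) e ⟩
    weight d (clique u) + + suc m ∎
    where
    open ≡-Reasoning
    cancel : ∀ a s → (a - s) + s ≡ a
    cancel = solve-∀

  IsTWPow-functional : ∀ t {w w′} → IsTWPow t u w → IsTWPow t u w′ → w ≡ w′
  IsTWPow-functional (+ m)     refl     refl       = refl
  IsTWPow-functional -[1+ m ] {w} {w′} (sc , e) (sc′ , e′) =
    cong₂ _,_ (iter-injective (rotate-injective D) (suc m) (cong proj₁ same)) (cong proj₂ same)
    where
    open ≡-Reasoning
    D = + suc (suc n ℕ.+ d)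
    same : (iter (suc m) (rotate D) (clique w) , indep w)
             ≡ (iter (suc m) (rotate D) (clique w′) , indep w′)
    same = begin
      (iter (suc m) (rotate D) (clique w) , indep w)
        ≡⟨ iter-TW w (SortedCompact⇒WindowConfig sc) (suc m) ⟨
      iter (suc m) TW w
        ≡⟨ trans e (sym e′) ⟩
      iter (suc m) TW w′
        ≡⟨ iter-TW w′ (SortedCompact⇒WindowConfig sc′) (suc m) ⟩
      (iter (suc m) (rotate D) (clique w′) , indep w′) ∎

  IsTWPow-total : ∀ t → ∃ (IsTWPow t u)
  IsTWPow-total (+ m)     = iter m TW u , refl
  IsTWPow-total -[1+ m ] =
    let k , Wk , e = iter-rotate-onto-Window (suc m) (proj₁ W)
    in (k , indep u) , WindowConfig⇒SortedCompact (Wk , proj₂ W)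
     , trans (iter-TW (k , indep u) (Wk , proj₂ W) (suc m)) (cong (_, indep u) e)

proposition5p7 : (n d : ℕ) → n ≥ 1 →
    (u v : Config n d) → SortedCompact u → SortedCompact v →
      -- (a)
      ((u ≡ TW v → indep u ≡ indep v) × (u ≡TW v → indep u ≡ indep v))
      -- (b)
    × (QSNonNeg d (clique u) ⇔ (weight d (clique u) ≡ + 0))
      -- (c)
    × (weight d (clique (TW u)) ≡ weight d (clique u) - + 1)
    × (∃ λ (w : Config n d) →
         IsTWPow (weight d (clique u)) u w
         × QSNonNeg d (clique w)
         × (∀ (t : ℤ) (w′ : Config n d) → IsTWPow t u w′ →
              QSNonNeg d (clique w′) → clique w′ ≡ clique w))
proposition5p7 (suc n) d (s≤s z≤n) u v su sv =
    (IsTWPow⇒indep Wv (+ 1) , λ (t , u≡TWᵗv) → IsTWPow⇒indep Wv t u≡TWᵗv)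
  , qs⇔weight≡0 Wu
  , IsTWPow⇒weight Wu (+ 1) refl
  , (w , u→w , Equivalence.from (qs⇔weight≡0 (IsTWPow⇒Window Wu W₀ u→w)) weight-w≡0 , unique)
  where
  Wu = SortedCompact⇒WindowConfig su
  Wv = SortedCompact⇒WindowConfig sv
  W₀ = weight d (clique u)
  w = proj₁ (IsTWPow-total Wu W₀)
  u→w = proj₂ (IsTWPow-total Wu W₀)
  qs⇔weight≡0 : {x : Config (suc n) d} → WindowConfig x →
                QSNonNeg d (clique x) ⇔ (weight d (clique x) ≡ 0ℤ)
  qs⇔weight≡0 Wx = QSNonNeg⇔weight≡0 d (proj₁ Wx)
  weight-w≡0 : weight d (clique w) ≡ 0ℤ
  weight-w≡0 = trans (IsTWPow⇒weight Wu W₀ u→w) (ℤ.+-inverseʳ W₀)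
  unique : ∀ t w′ → IsTWPow t u w′ → QSNonNeg d (clique w′) → clique w′ ≡ clique w
  unique t w′ u→w′ qs′ =
    cong clique (IsTWPow-functional Wu W₀ (subst (λ s → IsTWPow s u w′) t≡W₀ u→w′) u→w)
    where
    t≡W₀ : t ≡ W₀
    t≡W₀ = sym (ℤ.i-j≡0⇒i≡j W₀ t (trans (sym (IsTWPow⇒weight Wu t u→w′))
                                        (Equivalence.to (qs⇔weight≡0 (IsTWPow⇒Window Wu t u→w′)) qs′)))
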